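{- For any ASM $A\in\mathsf{ASM}_n(2143,3412)$, all entries of $A$ equal to $-1$ lie in a single row or in a single column.
   Context: An alternating sign matrix (ASM) is a square matrix with entries in $\{0,1,-1\}$ such that every row and every column sums to $1$ and the nonzero entries of each row and each column alternate in sign. A permutation $\pi\in S_k$ is identified with the $k\times k$ matrix whose row $i$ has a $1$ in column $\pi(i)$ and $0$ elsewhere. An $n\times n$ ASM $A$ classically contains $\pi\in S_k$ if there are order-preserving injections $f,g:[k]\to[n]$ with $A_{f(i),g(\pi(i))}=1$ for all $i$; otherwise $A$ classically avoids $\pi$. $\mathsf{ASM}_n(2143,3412)$ is the set of $n\times n$ ASMs classically avoiding both $2143$ and $3412$. -}

module Defs where

open import Data.Nat using (ℕ)
open import Data.Fin using (Fin; zero; suc; _<_)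
open import Data.Integer using (ℤ; +_; -[1+_])
open import Data.Product using (Σ; ∃; _×_; _,_)
open import Data.Sum using (_⊎_)
open import Relation.Nullary using (¬_)
open import Relation.Binary.PropositionalEquality using (_≡_; _≢_)
open import Data.Vec.Functional using (Vector; foldr)
open import Data.Integer using (_+_)

Matrix : ℕ → Set
Matrix n = Fin n → Fin n → ℤ

-1ℤ : ℤ
-1ℤ = -[1+ 0 ]

sumℤ : ∀ {n} → Vector ℤ n → ℤ
sumℤ = foldr _+_ (+ 0)

-- Nonzero entries of a vector alternate in sign: any two consecutive
-- nonzero entries (no nonzero entry strictly between them) differ.
-- (Entries being in {0,1,-1}, "differ" means opposite signs.)
Alternating : ∀ {n} → Vector ℤ n → Set
Alternating {n} v =
  (j j' : Fin n) → j < j' → v j ≢ + 0 → v j' ≢ + 0 →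
  ((k : Fin n) → j < k → k < j' → v k ≡ + 0) → v j ≢ v j'

record IsASM {n : ℕ} (A : Matrix n) : Set where
  field
    entries : (i j : Fin n) → (A i j ≡ + 0) ⊎ (A i j ≡ + 1) ⊎ (A i j ≡ -1ℤ)
    rowSum  : (i : Fin n) → sumℤ (λ j → A i j) ≡ + 1
    colSum  : (j : Fin n) → sumℤ (λ i → A i j) ≡ + 1
    rowAlt  : (i : Fin n) → Alternating (λ j → A i j)
    colAlt  : (j : Fin n) → Alternating (λ i → A i j)

StrictlyIncreasing : ∀ {k n} → (Fin k → Fin n) → Set
StrictlyIncreasing {k} f = (a b : Fin k) → a < b → f a < f b

-- A permutation π ∈ S_k, as a function Fin k → Fin k (row i has its 1 in column π i).
-- Classical containment of π in A.
Contains : ∀ {n k} → Matrix n → (Fin k → Fin k) → Set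
Contains {n} {k} A π =
  Σ (Fin k → Fin n) λ f → Σ (Fin k → Fin n) λ g →
    StrictlyIncreasing f × StrictlyIncreasing g × ((i : Fin k) → A (f i) (g (π i)) ≡ + 1)

Avoids : ∀ {n k} → Matrix n → (Fin k → Fin k) → Set
Avoids A π = ¬ Contains A π

-- 0-indexed one-line notation
p2143 : Fin 4 → Fin 4
p2143 zero = suc zero
p2143 (suc zero) = zero
p2143 (suc (suc zero)) = suc (suc (suc zero))
p2143 (suc (suc (suc zero))) = suc (suc zero)

p3412 : Fin 4 → Fin 4
p3412 zero = suc (suc zero)
p3412 (suc zero) = suc (suc (suc zero))
p3412 (suc (suc zero)) = zero
p3412 (suc (suc (suc zero))) = suc zero

InASM-2143-3412 : ∀ {n} → Matrix n → Set
InASM-2143-3412 A = IsASM A × Avoids A p2143 × Avoids A p3412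

-- In a {0,±1} vector whose nonzero entries alternate, consecutive nonzero entries
-- cancel in pairs, so the sum is 0 or the first nonzero entry; reading the vector
-- backwards, it is also 0 or the last nonzero entry. In an ASM every line sums to 1,
-- so each −1 has a +1 on both sides of it in its row and in its column. Given −1's at
-- (i,j) and (i',j') with i < i' and j ≠ j', the +1 above (i,j), the +1 below (i',j')
-- and the +1's beside them on the outer sides form a 2143 pattern if j < j' and a
-- 3412 pattern if j > j'. So any two −1's share a row or a column, and then all of
-- them share one row or one column.
module Submission where

open import Defs
open import Data.Nat using (ℕ; zero; suc; s≤s; z≤n) renaming (_<_ to _<ℕ_)
import Data.Nat.Properties as ℕₚ
open import Data.Fin using (Fin; zero; suc; _<_; opposite)
open import Data.Fin.Properties using (<-cmp; <-trans; any?; _≟_; toℕ<n; opposite-prop; opposite-involutive)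
open import Data.Integer using (ℤ; +_; _+_)
import Data.Integer as ℤ
import Data.Integer.Properties as ℤ
open import Data.Product using (Σ; _×_; _,_)
open import Data.Sum using (_⊎_; inj₁; inj₂)
open import Data.Empty using (⊥-elim)
open import Relation.Nullary using (Dec; yes; no)
open import Relation.Nullary.Decidable using (_×-dec_; ¬?)
open import Relation.Binary using (tri<; tri≈; tri>)
open import Relation.Binary.PropositionalEquality
open import Data.Vec.Functional using (Vector; tail; init; last; reverse)

IsUnit : ℤ → Set
IsUnit x = (x ≡ + 1) ⊎ (x ≡ -1ℤ)

IsSign : ℤ → Set
IsSign x = (x ≡ + 0) ⊎ IsUnit x

record IsSignVector {n : ℕ} (v : Vector ℤ n) : Set where
  field
    signs       : ∀ j → IsSign (v j)
    alternating : Alternating v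

open IsSignVector

isUnit : ∀ {x} → IsSign x → x ≢ + 0 → IsUnit x
isUnit (inj₁ x≡0) x≢0 = ⊥-elim (x≢0 x≡0)
isUnit (inj₂ u)   _   = u

distinct-units-cancel : ∀ {x y} → IsUnit x → IsUnit y → x ≢ y → x + y ≡ + 0
distinct-units-cancel (inj₁ refl) (inj₁ refl) x≢y = ⊥-elim (x≢y refl)
distinct-units-cancel (inj₁ refl) (inj₂ refl) _   = refl
distinct-units-cancel (inj₂ refl) (inj₁ refl) _   = refl
distinct-units-cancel (inj₂ refl) (inj₂ refl) x≢y = ⊥-elim (x≢y refl)

unit≢0 : ∀ {x} → IsUnit x → x ≢ + 0
unit≢0 (inj₁ refl) ()
unit≢0 (inj₂ refl) ()

-1≢+1 : -1ℤ ≢ + 1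
-1≢+1 ()

isSignVector-tail : ∀ {n} {v : Vector ℤ (suc n)} → IsSignVector v → IsSignVector (tail v)
isSignVector-tail sv .signs j = sv .signs (suc j)
isSignVector-tail {v = v} sv .alternating j j' j<j' vj≢0 vj'≢0 between =
  sv .alternating (suc j) (suc j') (s≤s j<j') vj≢0 vj'≢0 between′
  where
  between′ : ∀ k → suc j < k → k < suc j' → v k ≡ + 0
  between′ (suc k) (s≤s j<k) (s≤s k<j') = between k j<k k<j'

sum≢0⇒sum-is-first-nonzero : ∀ {n} (v : Vector ℤ n) → IsSignVector v → sumℤ v ≢ + 0 →
  Σ (Fin n) λ k → v k ≡ sumℤ v × (∀ l → l < k → v l ≡ + 0)
sum≢0⇒sum-is-first-nonzero {zero}  v sv sum≢0 = ⊥-elim (sum≢0 refl)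
sum≢0⇒sum-is-first-nonzero {suc n} v sv sum≢0
  with sv .signs zero | sumℤ (tail v) ℤ.≟ + 0
... | inj₁ v₀≡0 | _ =
  let sum≡rest = trans (cong (λ x → x + sumℤ (tail v)) v₀≡0) (ℤ.+-identityˡ _)
      (k , vk≡rest , zeros) =
        sum≢0⇒sum-is-first-nonzero (tail v) (isSignVector-tail sv) (λ rest≡0 → sum≢0 (trans sum≡rest rest≡0))
  in suc k , trans vk≡rest (sym sum≡rest) , λ { zero _ → v₀≡0 ; (suc l) (s≤s l<k) → zeros l l<k }
... | inj₂ _ | yes rest≡0 =
  zero , sym (trans (cong (_+_ (v zero)) rest≡0) (ℤ.+-identityʳ _)) , λ _ ()
... | inj₂ v₀-unit | no rest≢0
  with sum≢0⇒sum-is-first-nonzero (tail v) (isSignVector-tail sv) rest≢0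
... | k , vk≡rest , zeros = ⊥-elim (sum≢0 (begin
  v zero + sumℤ (tail v)   ≡⟨ cong (_+_ (v zero)) vk≡rest ⟨
  v zero + v (suc k)       ≡⟨ distinct-units-cancel v₀-unit (isUnit (sv .signs (suc k)) vk≢0) v₀≢vk ⟩
  + 0                      ∎))
  where
  open ≡-Reasoning
  vk≢0 : v (suc k) ≢ + 0
  vk≢0 vk≡0 = rest≢0 (trans (sym vk≡rest) vk≡0)
  v₀≢vk : v zero ≢ v (suc k)
  v₀≢vk = sv .alternating zero (suc k) (s≤s z≤n) (unit≢0 v₀-unit) vk≢0
    λ { (suc l) _ (s≤s l<k) → zeros l l<k }

minus-one⇒plus-one-before : ∀ {n} (v : Vector ℤ n) → IsSignVector v → sumℤ v ≡ + 1 →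
  ∀ j → v j ≡ -1ℤ → Σ (Fin n) λ k → k < j × v k ≡ + 1
minus-one⇒plus-one-before v sv sum≡1 j vj≡-1
  with sum≢0⇒sum-is-first-nonzero v sv (λ sum≡0 → unit≢0 (inj₁ refl) (trans (sym sum≡1) sum≡0))
... | k , vk≡sum , zeros with <-cmp k j
...   | tri< k<j _ _ = k , k<j , trans vk≡sum sum≡1
...   | tri≈ _ refl _ = ⊥-elim (-1≢+1 (trans (sym vj≡-1) (trans vk≡sum sum≡1)))
...   | tri> _ _ j<k = ⊥-elim (unit≢0 (inj₂ vj≡-1) (zeros j j<k))

opposite-< : ∀ {n} {i j : Fin n} → i < j → opposite j < opposite i
opposite-< {i = i} {j} i<j =
  subst₂ _<ℕ_ (sym (opposite-prop j)) (sym (opposite-prop i)) (ℕₚ.∸-monoʳ-< (s≤s i<j) (toℕ<n j))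

<-opposite : ∀ {n} {i j : Fin n} → i < opposite j → j < opposite i
<-opposite {i = i} {j} i<oj = subst (_< opposite i) (opposite-involutive j) (opposite-< i<oj)

opposite-<′ : ∀ {n} {i j : Fin n} → opposite i < j → opposite j < i
opposite-<′ {i = i} {j} oi<j = subst (opposite j <_) (opposite-involutive i) (opposite-< oi<j)

sum-init-last : ∀ {n} (v : Vector ℤ (suc n)) → sumℤ v ≡ sumℤ (init v) + last v
sum-init-last {zero}  v = trans (ℤ.+-identityʳ (v zero)) (sym (ℤ.+-identityˡ (v zero)))
sum-init-last {suc n} v = begin
  v zero + sumℤ (tail v)                        ≡⟨ cong (_+_ (v zero)) (sum-init-last (tail v)) ⟩
  v zero + (sumℤ (init (tail v)) + last v)      ≡⟨ ℤ.+-assoc (v zero) _ _ ⟨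
  sumℤ (init v) + last v                        ∎
  where open ≡-Reasoning

sum-reverse : ∀ {n} (v : Vector ℤ n) → sumℤ (reverse v) ≡ sumℤ v
sum-reverse {zero}  v = refl
sum-reverse {suc n} v = begin
  last v + sumℤ (reverse (init v))   ≡⟨ cong (_+_ (last v)) (sum-reverse (init v)) ⟩
  last v + sumℤ (init v)             ≡⟨ ℤ.+-comm (last v) _ ⟩
  sumℤ (init v) + last v             ≡⟨ sum-init-last v ⟨
  sumℤ v                             ∎
  where open ≡-Reasoning

isSignVector-reverse : ∀ {n} {v : Vector ℤ n} → IsSignVector v → IsSignVector (reverse v)
isSignVector-reverse sv .signs j = sv .signs (opposite j)
isSignVector-reverse {v = v} sv .alternating j j' j<j' vj≢0 vj'≢0 between =
  ≢-sym (sv .alternating (opposite j') (opposite j) (opposite-< j<j') vj'≢0 vj≢0 between′)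
  where
  between′ : ∀ k → opposite j' < k → k < opposite j → v k ≡ + 0
  between′ k oj'<k k<oj =
    subst (λ l → v l ≡ + 0) (opposite-involutive k) (between (opposite k) (<-opposite k<oj) (opposite-<′ oj'<k))

minus-one⇒plus-one-after : ∀ {n} (v : Vector ℤ n) → IsSignVector v → sumℤ v ≡ + 1 →
  ∀ j → v j ≡ -1ℤ → Σ (Fin n) λ k → j < k × v k ≡ + 1
minus-one⇒plus-one-after v sv sum≡1 j vj≡-1
  with minus-one⇒plus-one-before (reverse v) (isSignVector-reverse sv) (trans (sum-reverse v) sum≡1)
         (opposite j) (subst (λ l → v l ≡ -1ℤ) (sym (opposite-involutive j)) vj≡-1)
... | k , k<oj , vok≡1 = opposite k , <-opposite k<oj , vok≡1

quadruple : ∀ {n} → Fin n → Fin n → Fin n → Fin n → Fin 4 → Fin n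
quadruple a b c d zero                   = a
quadruple a b c d (suc zero)             = b
quadruple a b c d (suc (suc zero))       = c
quadruple a b c d (suc (suc (suc zero))) = d

quadruple-increasing : ∀ {n} {a b c d : Fin n} → a < b → b < c → c < d →
  StrictlyIncreasing (quadruple a b c d)
quadruple-increasing a<b b<c c<d zero (suc zero)                   _ = a<b
quadruple-increasing a<b b<c c<d zero (suc (suc zero))             _ = <-trans a<b b<c
quadruple-increasing a<b b<c c<d zero (suc (suc (suc zero)))       _ = <-trans a<b (<-trans b<c c<d)
quadruple-increasing a<b b<c c<d (suc zero) (suc (suc zero))       _ = b<c
quadruple-increasing a<b b<c c<d (suc zero) (suc (suc (suc zero))) _ = <-trans b<c c<d
quadruple-increasing a<b b<c c<d (suc (suc zero)) (suc (suc (suc zero))) _ = c<d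
quadruple-increasing _ _ _ zero zero ()
quadruple-increasing _ _ _ (suc _) zero ()
quadruple-increasing _ _ _ (suc zero) (suc zero) (s≤s ())
quadruple-increasing _ _ _ (suc (suc _)) (suc zero) (s≤s ())
quadruple-increasing _ _ _ (suc (suc zero)) (suc (suc zero)) (s≤s (s≤s ()))
quadruple-increasing _ _ _ (suc (suc (suc zero))) (suc (suc zero)) (s≤s (s≤s ()))
quadruple-increasing _ _ _ (suc (suc (suc zero))) (suc (suc (suc zero))) (s≤s (s≤s (s≤s ())))

module _ {n : ℕ} {A : Matrix n} (asm : IsASM A) where
  open IsASM asm

  private
    row : ∀ i → IsSignVector (λ j → A i j)
    row i = record { signs = entries i ; alternating = rowAlt i }

    column : ∀ j → IsSignVector (λ i → A i j)
    column j = record { signs = λ i → entries i j ; alternating = colAlt j }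

  plus-one-left : ∀ {i j} → A i j ≡ -1ℤ → Σ (Fin n) λ k → k < j × A i k ≡ + 1
  plus-one-left {i} {j} = minus-one⇒plus-one-before _ (row i) (rowSum i) j

  plus-one-right : ∀ {i j} → A i j ≡ -1ℤ → Σ (Fin n) λ k → j < k × A i k ≡ + 1
  plus-one-right {i} {j} = minus-one⇒plus-one-after _ (row i) (rowSum i) j

  plus-one-above : ∀ {i j} → A i j ≡ -1ℤ → Σ (Fin n) λ k → k < i × A k j ≡ + 1
  plus-one-above {i} {j} = minus-one⇒plus-one-before _ (column j) (colSum j) i

  plus-one-below : ∀ {i j} → A i j ≡ -1ℤ → Σ (Fin n) λ k → i < k × A k j ≡ + 1
  plus-one-below {i} {j} = minus-one⇒plus-one-after _ (column j) (colSum j) i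

  minus-ones-descending⇒contains-2143 : ∀ {i j i' j'} → A i j ≡ -1ℤ → A i' j' ≡ -1ℤ →
    i < i' → j < j' → Contains A p2143
  minus-ones-descending⇒contains-2143 a≡-1 a'≡-1 i<i' j<j'
    with plus-one-above a≡-1 | plus-one-left a≡-1 | plus-one-right a'≡-1 | plus-one-below a'≡-1
  ... | r , r<i , Arj≡1 | c , c<j , Aic≡1 | c' , j'<c' , Ai'c'≡1 | r' , i'<r' , Ar'j'≡1 =
    quadruple r _ _ r' , quadruple c _ _ c' ,
    quadruple-increasing r<i i<i' i'<r' , quadruple-increasing c<j j<j' j'<c' ,
    λ { zero → Arj≡1 ; (suc zero) → Aic≡1 ; (suc (suc zero)) → Ai'c'≡1 ; (suc (suc (suc zero))) → Ar'j'≡1 }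

  minus-ones-ascending⇒contains-3412 : ∀ {i j i' j'} → A i j ≡ -1ℤ → A i' j' ≡ -1ℤ →
    i < i' → j' < j → Contains A p3412
  minus-ones-ascending⇒contains-3412 a≡-1 a'≡-1 i<i' j'<j
    with plus-one-above a≡-1 | plus-one-right a≡-1 | plus-one-left a'≡-1 | plus-one-below a'≡-1
  ... | r , r<i , Arj≡1 | c , j<c , Aic≡1 | c' , c'<j' , Ai'c'≡1 | r' , i'<r' , Ar'j'≡1 =
    quadruple r _ _ r' , quadruple c' _ _ c ,
    quadruple-increasing r<i i<i' i'<r' , quadruple-increasing c'<j' j'<j j<c ,
    λ { zero → Arj≡1 ; (suc zero) → Aic≡1 ; (suc (suc zero)) → Ai'c'≡1 ; (suc (suc (suc zero))) → Ar'j'≡1 }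

  minus-ones-aligned : Avoids A p2143 → Avoids A p3412 → ∀ {i j i' j'} →
    A i j ≡ -1ℤ → A i' j' ≡ -1ℤ → (i ≡ i') ⊎ (j ≡ j')
  minus-ones-aligned avoids-2143 avoids-3412 {i} {j} {i'} {j'} a≡-1 a'≡-1
    with <-cmp i i' | <-cmp j j'
  ... | tri≈ _ i≡i' _ | _             = inj₁ i≡i'
  ... | _             | tri≈ _ j≡j' _ = inj₂ j≡j'
  ... | tri< i<i' _ _ | tri< j<j' _ _ = ⊥-elim (avoids-2143 (minus-ones-descending⇒contains-2143 a≡-1 a'≡-1 i<i' j<j'))
  ... | tri< i<i' _ _ | tri> _ _ j'<j = ⊥-elim (avoids-3412 (minus-ones-ascending⇒contains-3412 a≡-1 a'≡-1 i<i' j'<j))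
  ... | tri> _ _ i'<i | tri< j<j' _ _ = ⊥-elim (avoids-3412 (minus-ones-ascending⇒contains-3412 a'≡-1 a≡-1 i'<i j<j'))
  ... | tri> _ _ i'<i | tri> _ _ j'<j = ⊥-elim (avoids-2143 (minus-ones-descending⇒contains-2143 a'≡-1 a≡-1 i'<i j'<j))

pairwise-aligned⇒one-row-or-one-column : ∀ {m n} {P : Fin m → Fin n → Set} →
  (∀ i j → Dec (P i j)) →
  (∀ {i j i' j'} → P i j → P i' j' → (i ≡ i') ⊎ (j ≡ j')) →
  ((i : Fin m) (j : Fin n) (i' : Fin m) (j' : Fin n) → P i j → P i' j' → i ≡ i')
  ⊎ ((i : Fin m) (j : Fin n) (i' : Fin m) (j' : Fin n) → P i j → P i' j' → j ≡ j')
pairwise-aligned⇒one-row-or-one-column {P = P} P? aligned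
  with any? (λ i → any? (λ j → P? i j))
... | no empty = inj₁ λ i j _ _ p _ → ⊥-elim (empty (i , j , p))
... | yes (i₀ , j₀ , p₀)
  with any? (λ i → any? (λ j → P? i j ×-dec ¬? (i ≟ i₀)))
...   | no outside-row₀ = inj₁ λ i j i' j' p p' → trans (in-row₀ p) (sym (in-row₀ p'))
  where
  in-row₀ : ∀ {i j} → P i j → i ≡ i₀
  in-row₀ {i} {j} p with i ≟ i₀
  ... | yes i≡i₀ = i≡i₀
  ... | no  i≢i₀ = ⊥-elim (outside-row₀ (i , j , p , i≢i₀))
...   | yes (i₁ , j₁ , p₁ , i₁≢i₀) = inj₂ λ i j i' j' p p' → trans (in-column₀ p) (sym (in-column₀ p'))
  where
  j₁≡j₀ : j₁ ≡ j₀
  j₁≡j₀ with aligned p₁ p₀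
  ... | inj₁ i₁≡i₀ = ⊥-elim (i₁≢i₀ i₁≡i₀)
  ... | inj₂ j₁≡j₀ = j₁≡j₀
  in-column₀ : ∀ {i j} → P i j → j ≡ j₀
  in-column₀ p with aligned p p₀ | aligned p p₁
  ... | inj₂ j≡j₀ | _         = j≡j₀
  ... | inj₁ _    | inj₂ j≡j₁ = trans j≡j₁ j₁≡j₀
  ... | inj₁ i≡i₀ | inj₁ i≡i₁ = ⊥-elim (i₁≢i₀ (trans (sym i≡i₁) i≡i₀))

lemma5p1 : (n : ℕ) (A : Matrix n) → InASM-2143-3412 A →
    ((i j i' j' : Fin n) → A i j ≡ -1ℤ → A i' j' ≡ -1ℤ → i ≡ i')
    ⊎ ((i j i' j' : Fin n) → A i j ≡ -1ℤ → A i' j' ≡ -1ℤ → j ≡ j')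
lemma5p1 n A (asm , avoids-2143 , avoids-3412) =
  pairwise-aligned⇒one-row-or-one-column (λ i j → A i j ℤ.≟ -1ℤ)
    (minus-ones-aligned asm avoids-2143 avoids-3412)
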